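{- Let $d\ge1$ and let $n_1,\dots,n_d$ be powers of $2$ with $n_r\ge 2$ for all $r$. Run the following procedure on the grid $\prod_{r=1}^d[n_r]$: start with $v=(1,\dots,1)$ and $m=(1,\dots,1)$; while it is not the case that ($v_r=1$ for all $r\in[d-1]$ and $v_d=n_d$): set $j=1$; while $v_j+m_j>n_j$ or $v_j+m_j<1$, set $m_j\leftarrow -m_j$ and $j\leftarrow j+1$; then set $v_j\leftarrow v_j+m_j$. Then the sequence of vectors $v$ produced (including the initial one) visits every element of $\prod_{r=1}^d[n_r]$, and any two consecutive vectors in the sequence are adjacent, i.e. they differ by exactly $1$ in exactly one coordinate.
   Context: Here $[k]=\{1,\dots,k\}$. The vectors index the blocks of a grid partition of $[0,1]^d$ with $n_r$ blocks along coordinate $r$; adjacent indices correspond to blocks sharing a facet. -}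

module Defs where

open import Data.Nat using (ℕ; zero; suc; _^_; _≤_; _<_)
open import Data.Integer using (ℤ; +_; _+_; _-_; -_; ∣_∣) renaming (_<?_ to _<ℤ?_)
open import Data.Bool using (Bool; true; false; _∨_)
open import Data.Fin using (Fin; inject₁; fromℕ)
open import Data.Vec using (Vec; []; _∷_; lookup; replicate)
open import Data.Maybe using (Maybe; just; nothing)
open import Data.Product using (Σ; ∃; _×_; _,_; proj₁; proj₂)
open import Relation.Nullary using (¬_; does)
open import Relation.Binary.PropositionalEquality using (_≡_)

-- State of the procedure: the current vector v and the direction vector m.
State : ℕ → Set
State d = Vec ℤ d × Vec ℤ d

outOfRange : ℕ → ℤ → Bool
outOfRange n w = does (+ n <ℤ? w) ∨ does (w <ℤ? + 1)

-- Returns nothing if j runs past the last coordinate (procedure undefined).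
step : ∀ {d} → Vec ℕ d → Vec ℤ d → Vec ℤ d → Maybe (State d)
step [] [] [] = nothing
step (n ∷ ns) (v ∷ vs) (m ∷ ms) with outOfRange n (v + m)
... | false = just ((v + m) ∷ vs , m ∷ ms)
... | true with step ns vs ms
...   | nothing = nothing
...   | just (vs' , ms') = just (v ∷ vs' , (- m) ∷ ms')

initState : ∀ d → State d
initState d = replicate d (+ 1) , replicate d (+ 1)

-- Iterating the loop body; if the body is undefined the state is kept
-- (which makes the adjacency conclusion fail, so this is harmless).
run : ∀ {d} → Vec ℕ d → ℕ → State d
run {d} ns zero = initState d
run ns (suc k) with step ns (proj₁ (run ns k)) (proj₂ (run ns k))
... | nothing = run ns k
... | just s = s

vecAt : ∀ {d} → Vec ℕ d → ℕ → Vec ℤ d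
vecAt ns k = proj₁ (run ns k)

Terminal : ∀ {d'} → Vec ℕ (suc d') → Vec ℤ (suc d') → Set
Terminal {d'} ns v =
  (∀ (i : Fin d') → lookup v (inject₁ i) ≡ + 1) × (lookup v (fromℕ d') ≡ + lookup ns (fromℕ d'))

InGrid : ∀ {d} → Vec ℕ d → Vec ℤ d → Set
InGrid {d} ns x = ∀ (i : Fin d) → (+ 1 Data.Integer.≤ lookup x i) × (lookup x i Data.Integer.≤ + lookup ns i)

Adjacent : ∀ {d} → Vec ℤ d → Vec ℤ d → Set
Adjacent {d} x y = Σ (Fin d) λ i → (∣ lookup x i - lookup y i ∣ ≡ 1) × (∀ j → ¬ (j ≡ i) → lookup x j ≡ lookup y j)

IsPowerOfTwo : ℕ → Set
IsPowerOfTwo n = ∃ λ k → n ≡ 2 ^ k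

{-# OPTIONS --safe #-}
module Submission where

-- The procedure walks the grid in reflected mixed-radix Gray code order. Write
-- k = r + q n₁ with r < n₁: the k-th vector has first coordinate r + 1 if q is even and
-- n₁ − r if q is odd, and its remaining coordinates are those of the q-th vector of the
-- same order on n₂ × ⋯ × n_d; the direction m₁ is +1 or −1 accordingly.
-- One pass of the outer loop turns the k-th state into the (k+1)-st: the inner loop
-- reverses exactly the leading coordinates that have finished their sweep and carries
-- the move into the first one that has not. So the vectors produced are this order, a
-- bijection from [0, n₁ ⋯ n_d) onto the grid with consecutive vectors adjacent. As
-- n₂ ⋯ n_d is even, q is odd at the last index n₁ ⋯ n_d − 1, whose vector is therefore
-- (1, …, 1, n_d) by induction on d; by injectivity no earlier vector is.

open import Defs
open import Data.Bool using (true; false)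
open import Data.Bool.Properties using (∨-zeroʳ)
open import Data.Empty using (⊥-elim)
open import Data.Fin using (Fin; zero; suc)
open import Data.Integer as ℤ using (ℤ; +_; -_; ∣_∣; +≤+; +<+)
import Data.Integer.Properties as ℤ
open import Data.Maybe using (Maybe; just)
open import Data.Nat using (ℕ; zero; suc; _+_; _*_; _∸_; _^_; _≤_; _<_; z≤n; s≤s; NonZero; parity)
import Data.Nat.Properties as ℕ
open import Data.Nat.DivMod
  using (_/_; _%_; m≡m%n+[m/n]*n; m%n<n; [m+kn]%n≡m%n; m<n⇒m%n≡m; +-distrib-/-∣ʳ; m<n⇒m/n≡0; m*n/n≡m)
open import Data.Nat.Divisibility using (divides-refl)
open import Data.Parity as ℙ using (Parity; 0ℙ; 1ℙ; _⁻¹)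
open import Data.Parity.Properties using (suc-homo-⁻¹; *-homo-*; ⁻¹-selfInverse)
open import Data.Product using (Σ; ∃; _×_; _,_; proj₁; proj₂; uncurry)
open import Data.Sum using (inj₁; inj₂)
open import Data.Vec using (Vec; []; _∷_; lookup)
open import Data.Vec.Properties using (∷-injective)
open import Data.Vec.Relation.Unary.All as All using (All; []; _∷_)
open import Data.Vec.Relation.Unary.All.Properties using (lookup⁻)
open import Relation.Nullary using (¬_)
open import Relation.Nullary.Decidable using (dec-true; dec-false)
open import Relation.Binary.PropositionalEquality
  using (_≡_; refl; sym; trans; cong; cong₂; subst; subst₂; module ≡-Reasoning)
open import Algebra.Properties.AbelianGroup ℤ.+-0-abelianGroup using (xyx⁻¹≈y)
open import Algebra.Properties.CommutativeSemigroup ℕ.+-commutativeSemigroup using (x∙yz≈y∙xz)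

product : ∀ {d} → Vec ℕ d → ℕ
product [] = 1
product (n ∷ ns) = n * product ns

data Digits (n : ℕ) : ℕ → Set where
  digits : ∀ r q → r < n → Digits n (r + q * n)

toDigits : ∀ n k .{{_ : NonZero n}} → Digits n k
toDigits n k = subst (Digits n) (sym (m≡m%n+[m/n]*n k n)) (digits (k % n) (k / n) (m%n<n k n))

module _ {r q n : ℕ} .{{_ : NonZero n}} (r<n : r < n) where

  [r+q*n]%n≡r : (r + q * n) % n ≡ r
  [r+q*n]%n≡r = trans ([m+kn]%n≡m%n r q n) (m<n⇒m%n≡m r<n)

  [r+q*n]/n≡q : (r + q * n) / n ≡ q
  [r+q*n]/n≡q = trans (+-distrib-/-∣ʳ r (divides-refl q)) (cong₂ _+_ (m<n⇒m/n≡0 r<n) (m*n/n≡m q n))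

r+q*n<n*p : ∀ {r q n p} → r < n → q < p → r + q * n < n * p
r+q*n<n*p {r} {q} {n} {p} r<n q<p = begin-strict
  r + q * n  <⟨ ℕ.+-monoˡ-< (q * n) r<n ⟩
  n + q * n  ≤⟨ ℕ.*-monoˡ-≤ n q<p ⟩
  p * n      ≡⟨ ℕ.*-comm p n ⟩
  n * p      ∎
  where open ℕ.≤-Reasoning

r+q*n<n*p⇒q<p : ∀ {r q n p} → r + q * n < n * p → q < p
r+q*n<n*p⇒q<p {r} {q} {n} {p} r+q*n<n*p = ℕ.*-cancelʳ-< n q p (begin-strict
  q * n      ≤⟨ ℕ.m≤n+m (q * n) r ⟩
  r + q * n  <⟨ r+q*n<n*p ⟩
  n * p      ≡⟨ ℕ.*-comm n p ⟩
  p * n      ∎)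
  where open ℕ.≤-Reasoning

[1+a]*[1+b]∸1≡a+b*[1+a] : ∀ a b → suc a * suc b ∸ 1 ≡ a + b * suc a
[1+a]*[1+b]∸1≡a+b*[1+a] a b = begin
  b + a * suc b    ≡⟨ cong (λ x → b + x) (ℕ.*-suc a b) ⟩
  b + (a + a * b)  ≡⟨ x∙yz≈y∙xz b a (a * b) ⟩
  a + (b + a * b)  ≡⟨ cong (λ x → a + (b + x)) (ℕ.*-comm a b) ⟩
  a + (b + b * a)  ≡⟨ cong (λ x → a + x) (ℕ.*-suc b a) ⟨
  a + b * suc a    ∎
  where open ≡-Reasoning

parity-suc : ∀ q → parity (suc q) ≡ parity q ⁻¹
parity-suc q = sym (⁻¹-selfInverse (suc-homo-⁻¹ q))

parity-pred : ∀ {m} → 0 < m → parity m ≡ 0ℙ → parity (m ∸ 1) ≡ 1ℙ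
parity-pred {suc m} _ even = trans (sym (suc-homo-⁻¹ m)) (cong _⁻¹ even)

EvenPositive : ℕ → Set
EvenPositive n = 0 < n × parity n ≡ 0ℙ

powerOfTwo-evenPositive : ∀ {n} → IsPowerOfTwo n → 2 ≤ n → EvenPositive n
powerOfTwo-evenPositive (zero , refl) (s≤s ())
powerOfTwo-evenPositive (suc k , refl) 1<n = ℕ.<-trans (s≤s z≤n) 1<n , *-homo-* 2 (2 ^ k)

product-positive : ∀ {d} {ns : Vec ℕ d} → All (0 <_) ns → 0 < product ns
product-positive [] = s≤s z≤n
product-positive (0<n ∷ 0<ns) = ℕ.*-mono-≤ 0<n (product-positive 0<ns)

product-even : ∀ {d} n (ns : Vec ℕ d) → parity n ≡ 0ℙ → parity (product (n ∷ ns)) ≡ 0ℙ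
product-even n ns even = trans (*-homo-* n (product ns)) (cong (λ p → p ℙ.* parity (product ns)) even)

InRange : ℕ → ℤ → Set
InRange n w = + 1 ℤ.≤ w × w ℤ.≤ + n

outOfRange-inRange : ∀ {n w} → InRange n w → outOfRange n w ≡ false
outOfRange-inRange {n} {w} (1≤w , w≤n)
  rewrite dec-false (+ n ℤ.<? w) (ℤ.≤⇒≯ w≤n) | dec-false (w ℤ.<? + 1) (ℤ.≤⇒≯ 1≤w) = refl

outOfRange-above : ∀ {n w} → + n ℤ.< w → outOfRange n w ≡ true
outOfRange-above {n} {w} n<w rewrite dec-true (+ n ℤ.<? w) n<w = refl

outOfRange-below : ∀ {n w} → w ℤ.< + 1 → outOfRange n w ≡ true
outOfRange-below {n} {w} w<1 rewrite dec-true (w ℤ.<? + 1) w<1 = ∨-zeroʳ _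

sweep : ℕ → Parity → ℕ → ℤ
sweep n 0ℙ r = + suc r
sweep n 1ℙ r = + (n ∸ r)

direction : Parity → ℤ
direction 0ℙ = ℤ.1ℤ
direction 1ℙ = ℤ.-1ℤ

direction-⁻¹ : ∀ p → direction (p ⁻¹) ≡ - direction p
direction-⁻¹ 0ℙ = refl
direction-⁻¹ 1ℙ = refl

sweep-inRange : ∀ {n r} p → r < n → InRange n (sweep n p r)
sweep-inRange 0ℙ r<n = +≤+ (s≤s z≤n) , +≤+ r<n
sweep-inRange {n} {r} 1ℙ r<n = +≤+ (ℕ.m<n⇒0<n∸m r<n) , +≤+ (ℕ.m∸n≤m n r)

sweep-suc : ∀ {n r} p → suc r < n → sweep n p r ℤ.+ direction p ≡ sweep n p (suc r)
sweep-suc {r = r} 0ℙ _ = cong +_ (ℕ.+-comm (suc r) 1)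
sweep-suc 1ℙ 1+r<n = cong (λ m → + m ℤ.+ ℤ.-1ℤ) (ℕ.+-∸-assoc 1 (ℕ.<⇒≤ 1+r<n))

sweep-overflow : ∀ n p → outOfRange (suc n) (sweep (suc n) p n ℤ.+ direction p) ≡ true
sweep-overflow n 0ℙ = outOfRange-above (+<+ (ℕ.m<m+n (suc n) (s≤s z≤n)))
sweep-overflow n 1ℙ rewrite ℕ.m+n∸n≡m 1 n = outOfRange-below {suc n} {+ 0} (+<+ (s≤s z≤n))

sweep-reflect : ∀ n p → sweep (suc n) (p ⁻¹) 0 ≡ sweep (suc n) p n
sweep-reflect n 0ℙ = refl
sweep-reflect n 1ℙ = cong +_ (sym (ℕ.m+n∸n≡m 1 n))

sweep-injective : ∀ {n r s} p → r < n → s < n → sweep n p r ≡ sweep n p s → r ≡ s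
sweep-injective 0ℙ _ _ eq = ℕ.suc-injective (ℤ.+-injective eq)
sweep-injective 1ℙ r<n s<n eq = ℕ.∸-cancelˡ-≡ (ℕ.<⇒≤ r<n) (ℕ.<⇒≤ s<n) (ℤ.+-injective eq)

sweep-surjective : ∀ {n w} p → InRange n w → ∃ λ r → r < n × sweep n p r ≡ w
sweep-surjective 0ℙ (+≤+ (s≤s z≤n) , +≤+ a<n) = _ , a<n , refl
sweep-surjective {n} 1ℙ (+≤+ (s≤s (z≤n {a})) , +≤+ a<n) =
  n ∸ suc a , ℕ.∸-monoʳ-< (s≤s z≤n) a<n , cong +_ (ℕ.m∸[m∸n]≡n a<n)

step-inRange : ∀ {d n v m} {ns : Vec ℕ d} {vs ms} → outOfRange n (v ℤ.+ m) ≡ false →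
               step (n ∷ ns) (v ∷ vs) (m ∷ ms) ≡ just ((v ℤ.+ m) ∷ vs , m ∷ ms)
step-inRange eq rewrite eq = refl

step-outOfRange : ∀ {d n v m} {ns : Vec ℕ d} {vs ms vs′ ms′} → outOfRange n (v ℤ.+ m) ≡ true →
                  step ns vs ms ≡ just (vs′ , ms′) →
                  step (n ∷ ns) (v ∷ vs) (m ∷ ms) ≡ just (v ∷ vs′ , - m ∷ ms′)
step-outOfRange eq eq′ rewrite eq | eq′ = refl

prepend : ∀ {d} → ℕ → ℕ → ℕ → State d → State (suc d)
prepend n r q (vs , ms) = sweep n (parity q) r ∷ vs , direction (parity q) ∷ ms

-- For n = 0 the grid is empty and any state will do.
gray : ∀ {d} → Vec ℕ d → ℕ → State d
gray [] k = [] , []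
gray (zero ∷ ns) k = prepend 0 0 0 (gray ns 0)
gray (suc n ∷ ns) k = prepend (suc n) (k % suc n) (k / suc n) (gray ns (k / suc n))

gray-digits : ∀ {d n r} q (ns : Vec ℕ d) → r < suc n →
              gray (suc n ∷ ns) (r + q * suc n) ≡ prepend (suc n) r q (gray ns q)
gray-digits q ns r<n rewrite [r+q*n]%n≡r {q = q} r<n | [r+q*n]/n≡q {q = q} r<n = refl

step-advance : ∀ {d n r} q {ns : Vec ℕ d} (s : State d) → suc r < n →
               uncurry (step (n ∷ ns)) (prepend n r q s) ≡ just (prepend n (suc r) q s)
step-advance {n = n} {r} q {ns} (vs , ms) 1+r<n = begin
  step (n ∷ ns) (sweep n p r ∷ vs) (direction p ∷ ms)
    ≡⟨ step-inRange {v = sweep n p r} (outOfRange-inRange inRange) ⟩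
  just (sweep n p r ℤ.+ direction p ∷ vs , direction p ∷ ms)
    ≡⟨ cong (λ w → just (w ∷ vs , direction p ∷ ms)) (sweep-suc p 1+r<n) ⟩
  just (sweep n p (suc r) ∷ vs , direction p ∷ ms)
    ∎
  where
  open ≡-Reasoning
  p : Parity
  p = parity q
  inRange : InRange n (sweep n p r ℤ.+ direction p)
  inRange = subst (InRange n) (sym (sweep-suc p 1+r<n)) (sweep-inRange p 1+r<n)

step-carry : ∀ {d n} q {ns : Vec ℕ d} {s s′ : State d} → uncurry (step ns) s ≡ just s′ →
             uncurry (step (suc n ∷ ns)) (prepend (suc n) n q s) ≡ just (prepend (suc n) 0 (suc q) s′)
step-carry {n = n} q eq rewrite parity-suc q | sweep-reflect n (parity q) | direction-⁻¹ (parity q) =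
  step-outOfRange (sweep-overflow n (parity q)) eq

step-gray : ∀ {d} (ns : Vec ℕ d) k → suc k < product ns →
            uncurry (step ns) (gray ns k) ≡ just (gray ns (suc k))
step-gray [] k (s≤s ())
step-gray {suc d} (suc n ∷ ns) k 1+k<P with toDigits (suc n) k
... | digits r q r<1+n with ℕ.m≤n⇒m<n∨m≡n (ℕ.≤-pred r<1+n)
...   | inj₁ r<n = begin
  next (gray n∷ns (r + q * suc n))              ≡⟨ cong next (gray-digits q ns r<1+n) ⟩
  next (prepend (suc n) r q (gray ns q))        ≡⟨ step-advance q (gray ns q) (s≤s r<n) ⟩
  just (prepend (suc n) (suc r) q (gray ns q))  ≡⟨ cong just (gray-digits q ns (s≤s r<n)) ⟨
  just (gray n∷ns (suc r + q * suc n))          ∎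
  where
  open ≡-Reasoning
  n∷ns : Vec ℕ (suc d)
  n∷ns = suc n ∷ ns
  next : State (suc d) → Maybe (State (suc d))
  next = uncurry (step n∷ns)
...   | inj₂ refl = begin
  next (gray n∷ns (n + q * suc n))                     ≡⟨ cong next (gray-digits q ns r<1+n) ⟩
  next (prepend (suc n) n q (gray ns q))               ≡⟨ step-carry q (step-gray ns q 1+q<P) ⟩
  just (prepend (suc n) 0 (suc q) (gray ns (suc q)))   ≡⟨ cong just (gray-digits (suc q) ns (s≤s z≤n)) ⟨
  just (gray n∷ns (suc q * suc n))                     ∎
  where
  open ≡-Reasoning
  n∷ns : Vec ℕ (suc d)
  n∷ns = suc n ∷ ns
  next : State (suc d) → Maybe (State (suc d))
  next = uncurry (step n∷ns)
  1+q<P : suc q < product ns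
  1+q<P = r+q*n<n*p⇒q<p {0} {suc q} {suc n} 1+k<P

0<m*n⇒0<n : ∀ m {n} → 0 < m * n → 0 < n
0<m*n⇒0<n m {zero} 0<m*0 = subst (0 <_) (ℕ.*-zeroʳ m) 0<m*0
0<m*n⇒0<n m {suc n} _ = s≤s z≤n

gray-zero : ∀ {d} (ns : Vec ℕ d) → 0 < product ns → gray ns 0 ≡ initState d
gray-zero [] _ = refl
gray-zero (zero ∷ ns) ()
gray-zero (suc n ∷ ns) 0<P rewrite gray-zero ns (0<m*n⇒0<n (suc n) 0<P) = refl

run-gray : ∀ {d} (ns : Vec ℕ d) k → k < product ns → run ns k ≡ gray ns k
run-gray ns zero 0<P = sym (gray-zero ns 0<P)
run-gray ns (suc k) 1+k<P rewrite run-gray ns k (ℕ.<-trans (ℕ.n<1+n k) 1+k<P) | step-gray ns k 1+k<P = refl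

IsUnit : ℤ → Set
IsUnit m = ∣ m ∣ ≡ 1

direction-isUnit : ∀ p → IsUnit (direction p)
direction-isUnit 0ℙ = refl
direction-isUnit 1ℙ = refl

gray-isUnit : ∀ {d} (ns : Vec ℕ d) k → All IsUnit (proj₂ (gray ns k))
gray-isUnit [] k = []
gray-isUnit (zero ∷ ns) k = direction-isUnit 0ℙ ∷ gray-isUnit ns 0
gray-isUnit (suc n ∷ ns) k = direction-isUnit (parity (k / suc n)) ∷ gray-isUnit ns (k / suc n)

adjacent-here : ∀ {d x y} {zs : Vec ℤ d} → ∣ x ℤ.- y ∣ ≡ 1 → Adjacent (x ∷ zs) (y ∷ zs)
adjacent-here ∣x-y∣≡1 = zero , ∣x-y∣≡1 , λ { zero 0≢0 → ⊥-elim (0≢0 refl) ; (suc j) _ → refl }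

adjacent-there : ∀ {d z} {xs ys : Vec ℤ d} → Adjacent xs ys → Adjacent (z ∷ xs) (z ∷ ys)
adjacent-there (i , ∣xᵢ-yᵢ∣≡1 , same) =
  suc i , ∣xᵢ-yᵢ∣≡1 , λ { zero _ → refl ; (suc j) 1+j≢1+i → same j (λ j≡i → 1+j≢1+i (cong suc j≡i)) }

step-adjacent : ∀ {d} (ns : Vec ℕ d) vs {ms vs′ ms′} → All IsUnit ms →
                step ns vs ms ≡ just (vs′ , ms′) → Adjacent vs vs′
step-adjacent [] [] {[]} [] ()
step-adjacent (n ∷ ns) (v ∷ vs) {m ∷ ms} (∣m∣≡1 ∷ units) eq with outOfRange n (v ℤ.+ m)
... | false with refl ← eq =
  adjacent-here (trans (ℤ.∣i-j∣≡∣j-i∣ v (v ℤ.+ m)) (trans (cong ∣_∣ (xyx⁻¹≈y v m)) ∣m∣≡1))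
... | true with step ns vs ms in eq′
...   | just _ with refl ← eq = adjacent-there (step-adjacent ns vs units eq′)

gray-injective : ∀ {d} (ns : Vec ℕ d) {k k′} → k < product ns → k′ < product ns →
                 proj₁ (gray ns k) ≡ proj₁ (gray ns k′) → k ≡ k′
gray-injective [] (s≤s z≤n) (s≤s z≤n) _ = refl
gray-injective (suc n ∷ ns) {k} {k′} k<P k′<P eq with toDigits (suc n) k | toDigits (suc n) k′
... | digits r q r<n | digits r′ q′ r′<n
  with head≡ , tail≡ ← ∷-injective (subst₂ _≡_ (cong proj₁ (gray-digits q ns r<n))
                                               (cong proj₁ (gray-digits q′ ns r′<n)) eq)
  with refl ← gray-injective ns (r+q*n<n*p⇒q<p k<P) (r+q*n<n*p⇒q<p k′<P) tail≡
  = cong (λ s → s + q * suc n) (sweep-injective (parity q) r<n r′<n head≡)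

gray-surjective : ∀ {d} (ns : Vec ℕ d) {x} → InGrid ns x →
                  ∃ λ k → k < product ns × proj₁ (gray ns k) ≡ x
gray-surjective [] {[]} _ = 0 , s≤s z≤n , refl
gray-surjective (zero ∷ ns) {_ ∷ _} x∈grid with _ , () , _ ← sweep-surjective 0ℙ (x∈grid zero)
gray-surjective (suc n ∷ ns) {_ ∷ _} x∈grid
  with q , q<P , tail≡ ← gray-surjective ns (λ i → x∈grid (suc i))
  with r , r<n , head≡ ← sweep-surjective (parity q) (x∈grid zero)
  = r + q * suc n , r+q*n<n*p r<n q<P , trans (cong proj₁ (gray-digits q ns r<n)) (cong₂ _∷_ head≡ tail≡)

corner : ∀ {d′} → Vec ℕ (suc d′) → Vec ℤ (suc d′)
corner {zero} (n ∷ []) = + n ∷ []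
corner {suc _} (_ ∷ ns) = + 1 ∷ corner ns

terminal-corner : ∀ {d′} (ns : Vec ℕ (suc d′)) → Terminal ns (corner ns)
terminal-corner {zero} (n ∷ []) = (λ ()) , refl
terminal-corner {suc _} (_ ∷ ns) with ones , last ← terminal-corner ns =
  (λ { zero → refl ; (suc i) → ones i }) , last

terminal⇒corner : ∀ {d′} (ns : Vec ℕ (suc d′)) {v} → Terminal ns v → v ≡ corner ns
terminal⇒corner {zero} (n ∷ []) {x ∷ []} (_ , x≡n) = cong (λ y → y ∷ []) x≡n
terminal⇒corner {suc _} (_ ∷ ns) {x ∷ xs} (ones , last) =
  cong₂ _∷_ (ones zero) (terminal⇒corner ns ((λ i → ones (suc i)) , last))

gray-last-digits : ∀ {d n} (ns : Vec ℕ d) → 0 < product ns →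
                   gray (suc n ∷ ns) (product (suc n ∷ ns) ∸ 1)
                   ≡ prepend (suc n) n (product ns ∸ 1) (gray ns (product ns ∸ 1))
gray-last-digits {n = n} ns 0<P with product ns | 0<P
... | suc b | _ =
  trans (cong (gray (suc n ∷ ns)) ([1+a]*[1+b]∸1≡a+b*[1+a] n b)) (gray-digits b ns ℕ.≤-refl)

gray-last : ∀ {d′} (ns : Vec ℕ (suc d′)) → All EvenPositive ns →
            proj₁ (gray ns (product ns ∸ 1)) ≡ corner ns
gray-last (zero ∷ _) ((() , _) ∷ _)
gray-last {zero} (suc n ∷ []) _ = cong proj₁ (gray-last-digits [] (s≤s z≤n))
gray-last {suc _} (suc n ∷ ns@(m ∷ ms)) (_ ∷ evenPositive@((_ , even) ∷ _)) = begin
  proj₁ (gray (suc n ∷ ns) (product (suc n ∷ ns) ∸ 1))  ≡⟨ cong proj₁ (gray-last-digits ns 0<P) ⟩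
  sweep (suc n) (parity (P ∸ 1)) n ∷ proj₁ (gray ns (P ∸ 1))
    ≡⟨ cong₂ (λ p → sweep (suc n) p n ∷_) (parity-pred 0<P (product-even m ms even))
             (gray-last ns evenPositive) ⟩
  + (suc n ∸ n) ∷ corner ns                              ≡⟨ cong (λ k → + k ∷ corner ns) (ℕ.m+n∸n≡m 1 n) ⟩
  + 1 ∷ corner ns                                        ∎
  where
  open ≡-Reasoning
  P : ℕ
  P = product ns
  0<P : 0 < P
  0<P = product-positive (All.map proj₁ evenPositive)

vecAt-gray : ∀ {d} (ns : Vec ℕ d) {k} → k < product ns → vecAt ns k ≡ proj₁ (gray ns k)
vecAt-gray ns {k} k<P = cong proj₁ (run-gray ns k k<P)

vecAt-adjacent : ∀ {d} (ns : Vec ℕ d) {k} → suc k < product ns → Adjacent (vecAt ns k) (vecAt ns (suc k))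
vecAt-adjacent ns {k} 1+k<P =
  subst₂ Adjacent (sym (vecAt-gray ns (ℕ.<-trans (ℕ.n<1+n k) 1+k<P))) (sym (vecAt-gray ns 1+k<P))
    (step-adjacent ns (proj₁ (gray ns k)) (gray-isUnit ns k) (step-gray ns k 1+k<P))

vecAt-injective : ∀ {d} (ns : Vec ℕ d) {k k′} → k < product ns → k′ < product ns →
                  vecAt ns k ≡ vecAt ns k′ → k ≡ k′
vecAt-injective ns k<P k′<P eq =
  gray-injective ns k<P k′<P (trans (sym (vecAt-gray ns k<P)) (trans eq (vecAt-gray ns k′<P)))

vecAt-surjective : ∀ {d} (ns : Vec ℕ d) {x} → InGrid ns x → ∃ λ k → k < product ns × vecAt ns k ≡ x
vecAt-surjective ns x∈grid with k , k<P , gray≡x ← gray-surjective ns x∈grid =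
  k , k<P , trans (vecAt-gray ns k<P) gray≡x

product∸1<product : ∀ {d} {ns : Vec ℕ d} → All EvenPositive ns → product ns ∸ 1 < product ns
product∸1<product evenPositive = ℕ.∸-monoʳ-< (s≤s z≤n) (product-positive (All.map proj₁ evenPositive))

vecAt-last : ∀ {d′} (ns : Vec ℕ (suc d′)) → All EvenPositive ns →
             vecAt ns (product ns ∸ 1) ≡ corner ns
vecAt-last ns evenPositive = trans (vecAt-gray ns (product∸1<product evenPositive)) (gray-last ns evenPositive)

lemma3 : (d' : ℕ) (ns : Vec ℕ (suc d')) →
    (∀ (r : Fin (suc d')) → IsPowerOfTwo (lookup ns r) × (2 ≤ lookup ns r)) →
    Σ ℕ λ N →
      Terminal ns (vecAt ns N)
      × (∀ k → k < N → ¬ Terminal ns (vecAt ns k))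
      × (∀ k → k < N → Adjacent (vecAt ns k) (vecAt ns (suc k)))
      × (∀ (x : Vec ℤ (suc d')) → InGrid ns x → Σ ℕ λ k → (k ≤ N) × (vecAt ns k ≡ x))
lemma3 d' ns hyp = N , terminal , nonTerminal , adjacent , visits
  where
  evenPositive : All EvenPositive ns
  evenPositive = lookup⁻ (λ r → uncurry powerOfTwo-evenPositive (hyp r))
  N : ℕ
  N = product ns ∸ 1
  N<P : N < product ns
  N<P = product∸1<product evenPositive
  terminal : Terminal ns (vecAt ns N)
  terminal = subst (Terminal ns) (sym (vecAt-last ns evenPositive)) (terminal-corner ns)
  nonTerminal : ∀ k → k < N → ¬ Terminal ns (vecAt ns k)
  nonTerminal k k<N T = ℕ.<⇒≢ k<N (vecAt-injective ns (ℕ.<-trans k<N N<P) N<P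
    (trans (terminal⇒corner ns T) (sym (vecAt-last ns evenPositive))))
  adjacent : ∀ k → k < N → Adjacent (vecAt ns k) (vecAt ns (suc k))
  adjacent k k<N = vecAt-adjacent ns (ℕ.≤-<-trans k<N N<P)
  visits : ∀ x → InGrid ns x → Σ ℕ λ k → (k ≤ N) × (vecAt ns k ≡ x)
  visits x x∈grid with k , k<P , vecAt≡x ← vecAt-surjective ns x∈grid = k , ℕ.<⇒≤pred k<P , vecAt≡x
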